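{- Let $H$ be a complete or anti-complete (edgeless) graph, and let $G=H[G_v : v\in V(H)]$ be an inflation of $H$ by nonempty graphs $G_v$. Then $\operatorname{lcw}(G)\le 1+\max_{v\in V(H)}\operatorname{lcw}(G_v)$.
   Context: The linear clique-width $\operatorname{lcw}(G)$ of a graph $G$ is the smallest number of labels needed to construct $G$ by a sequence of the operations: (1) introduce a new vertex with some label; (2) for labels $i\neq j$, add edges between all vertices labeled $i$ and all vertices labeled $j$; (3) for labels $i\ne j$, relabel all vertices labeled $i$ to $j$. Given a graph $H$ and nonempty graphs $G_v$ ($v\in V(H)$), the inflation $H[G_v : v\in V(H)]$ is the graph obtained by replacing each vertex $v$ of $H$ by a copy of $G_v$, where for distinct $u,v$ every vertex of $G_u$ is adjacent to every vertex of $G_v$ if $uv\in E(H)$ and to none of them otherwise. -}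

module Defs where

open import Data.Nat using (ℕ; zero; suc; _≤_)
open import Data.Bool using (Bool; true; false; _∧_; _∨_)
open import Data.Fin using (Fin; zero; suc; _≟_)
open import Data.Product using (Σ; _×_; _,_)
open import Data.List using (List; []; _∷_)
open import Relation.Nullary using (¬_; does)
open import Relation.Binary.PropositionalEquality using (_≡_; _≢_)
open import Function.Bundles using (_↔_; Inverse)
import Data.Empty
import Relation.Nullary
import Relation.Binary.PropositionalEquality

record Graph (V : Set) : Set where
  field
    adj   : V → V → Bool
    sym   : ∀ u v → adj u v ≡ adj v u
    irrefl : ∀ v → adj v v ≡ false
open Graph public

Iso : {A B : Set} → (A → A → Bool) → (B → B → Bool) → Set
Iso {A} {B} a b = Σ (A ↔ B) λ f → ∀ x y → a x y ≡ b (Inverse.to f x) (Inverse.to f y)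

-- Linear clique-width expressions with labels Fin k.
data Op (k : ℕ) : Set where
  intro   : Fin k → Op k
  join    : (i j : Fin k) → i ≢ j → Op k
  relabel : (i j : Fin k) → i ≢ j → Op k

record LGraph (k : ℕ) : Set where
  constructor lg
  field
    m   : ℕ
    lab : Fin m → Fin k
    ladj : Fin m → Fin m → Bool
open LGraph public

emptyLG : ∀ {k} → LGraph k
emptyLG = lg zero (λ ()) (λ ())

_==_ : ∀ {k} → Fin k → Fin k → Bool
i == j = does (i ≟ j)

step : ∀ {k} → Op k → LGraph k → LGraph k
step (intro i) (lg m l a) = lg (suc m) l' a'
  where
    l' : Fin (suc m) → _
    l' zero = i
    l' (suc u) = l u
    a' : Fin (suc m) → Fin (suc m) → Bool
    a' zero _ = false
    a' (suc u) zero = false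
    a' (suc u) (suc v) = a u v
step (join i j _) (lg m l a) =
  lg m l (λ u v → a u v ∨ ((l u == i) ∧ (l v == j)) ∨ ((l u == j) ∧ (l v == i)))
step (relabel i j _) (lg m l a) =
  lg m (λ u → if' (l u == i) j (l u)) a
  where
    if' : Bool → _ → _ → _
    if' true x _ = x
    if' false _ y = y

run : ∀ {k} → List (Op k) → LGraph k → LGraph k
run [] g = g
run (o ∷ os) g = run os (step o g)

-- lcw(G) ≤ k: G is isomorphic to the graph produced by some
-- linear clique-width expression using (at most) k labels.
LcwAtMost : ∀ {V} → ℕ → Graph V → Set
LcwAtMost k G = Σ (List (Op k)) λ e → Iso (ladj (run e emptyLG)) (adj G)

Complete : ∀ {V} → Graph V → Set
Complete G = ∀ u v → u ≢ v → adj G u v ≡ true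

AntiComplete : ∀ {V} → Graph V → Set
AntiComplete G = ∀ u v → adj G u v ≡ false

inflation : ∀ {h} {W : Fin h → Set} → Graph (Fin h) → ((v : Fin h) → Graph (W v))
          → Graph (Σ (Fin h) W)
inflation {h} {W} H G = record { adj = a ; sym = s ; irrefl = ir }
  where
    a : Σ (Fin h) W → Σ (Fin h) W → Bool
    a (u , x) (v , y) with u ≟ v
    ... | Relation.Nullary.yes Relation.Binary.PropositionalEquality.refl = adj (G u) x y
    ... | Relation.Nullary.no _ = adj H u v
    s : ∀ p q → a p q ≡ a q p
    s (u , x) (v , y) with u ≟ v | v ≟ u
    ... | Relation.Nullary.yes Relation.Binary.PropositionalEquality.refl | Relation.Nullary.yes Relation.Binary.PropositionalEquality.refl = sym (G u) x y
    ... | Relation.Nullary.yes Relation.Binary.PropositionalEquality.refl | Relation.Nullary.no ne = Data.Empty.⊥-elim (ne Relation.Binary.PropositionalEquality.refl)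
    ... | Relation.Nullary.no ne | Relation.Nullary.yes Relation.Binary.PropositionalEquality.refl = Data.Empty.⊥-elim (ne Relation.Binary.PropositionalEquality.refl)
    ... | Relation.Nullary.no _ | Relation.Nullary.no _ = sym H u v
    ir : ∀ p → a p p ≡ false
    ir (u , x) with u ≟ u
    ... | Relation.Nullary.yes Relation.Binary.PropositionalEquality.refl = irrefl (G u) x
    ... | Relation.Nullary.no ne = Data.Empty.⊥-elim (ne Relation.Binary.PropositionalEquality.refl)

{-# OPTIONS --safe #-}
-- The parts are added one at a time, all vertices of the graph built so far
-- sitting on the reserved label 0.  A new part G_v is built by its own
-- expression with every label shifted up by one; if H is complete, each label
-- i+1 is then joined with label 0, and only afterwards is each label i+1
-- relabelled to 0, so that label 0 holds exactly the old vertices while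
-- joining.  Since the old vertices share a single label, the new part becomes
-- completely joined to them or not at all, while the edges inside the part
-- are exactly those of G_v.
module Submission where

open import Defs
open import Data.Nat using (ℕ; suc; _≤_)
open import Data.Fin using (Fin)
open import Data.Sum using (_⊎_)

open import Data.Bool using (Bool; true; false; _∧_; _∨_; if_then_else_)
open import Data.Bool.ListAction using (any)
open import Data.Bool.Properties using (∨-assoc; ∨-identityʳ; ∨-zeroʳ; ∧-identityʳ; ∧-zeroʳ; if-float)
open import Data.Nat using (zero)
open import Data.Fin using (zero; suc; _≟_)
open import Data.Fin.Properties using (suc-injective)
open import Data.List using (List; []; _∷_; _++_; map; allFin)
open import Data.List.Membership.Propositional using (_∈_)
open import Data.List.Membership.Propositional.Properties using (∈-allFin)
open import Data.List.Relation.Unary.Any using (here; there)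
open import Data.Maybe using (Maybe; nothing; just; maybe)
open import Data.Product using (Σ; _,_; proj₁; proj₂)
open import Data.Sum using (inj₁; inj₂; [_,_]; [_,_]′)
open import Data.Sum.Algebra using (⊎-cong)
open import Function using (_∘_; const; id)
open import Function.Bundles using (_↔_; Inverse; mk↔ₛ′)
open import Function.Properties.Inverse using (↔-refl; ↔-trans)
open import Relation.Nullary using (yes; no; contradiction)
open import Relation.Nullary.Decidable using (dec-true)
open import Relation.Binary.PropositionalEquality using (_≡_; _≢_; _≗_; refl; trans; cong; cong₂; subst)
import Relation.Binary.PropositionalEquality as ≡

open Inverse using (to)

private
  variable
    k h : ℕ
    U V W A : Set

record Realises (c : LGraph k) (ℓ : V → Fin k) (a : V → V → Bool) : Set where
  field
    vertices : Fin (m c) ↔ V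
    lab≡     : ∀ x → lab c x ≡ ℓ (to vertices x)
    ladj≡    : ∀ x y → ladj c x y ≡ a (to vertices x) (to vertices y)
open Realises

realises⇒iso : {c : LGraph k} {ℓ : V → Fin k} {a : V → V → Bool} →
               Realises c ℓ a → Iso (ladj c) a
realises⇒iso R = vertices R , ladj≡ R

realises-↔ : {c : LGraph k} {ℓ : V → Fin k} {a : V → V → Bool}
             {ℓ′ : W → Fin k} {a′ : W → W → Bool} (f : V ↔ W) →
             (∀ v → ℓ v ≡ ℓ′ (to f v)) → (∀ u v → a u v ≡ a′ (to f u) (to f v)) →
             Realises c ℓ a → Realises c ℓ′ a′
realises-↔ f ℓ≡ a≡ R = record
  { vertices = ↔-trans (vertices R) f
  ; lab≡     = λ x → trans (lab≡ R x) (ℓ≡ _)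
  ; ladj≡    = λ x y → trans (ladj≡ R x y) (a≡ _ _)
  }

realises-≗ : {c : LGraph k} {ℓ ℓ′ : V → Fin k} {a a′ : V → V → Bool} →
             ℓ ≗ ℓ′ → (∀ u v → a u v ≡ a′ u v) → Realises c ℓ a → Realises c ℓ′ a′
realises-≗ = realises-↔ ↔-refl

realises-empty : {P : Fin 0 → Set} {ℓ : Σ (Fin 0) P → Fin k} {a : Σ (Fin 0) P → Σ (Fin 0) P → Bool} →
                 Realises emptyLG ℓ a
realises-empty = record
  { vertices = mk↔ₛ′ (λ ()) (λ { (() , _) }) (λ { (() , _) }) (λ ())
  ; lab≡     = λ ()
  ; ladj≡    = λ ()
  }

run-++ : (xs ys : List (Op k)) (c : LGraph k) → run (xs ++ ys) c ≡ run ys (run xs c)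
run-++ []       ys c = refl
run-++ (x ∷ xs) ys c = run-++ xs ys (step x c)

withIsolated : (V → V → Bool) → Maybe V → Maybe V → Bool
withIsolated a (just u) (just v) = a u v
withIsolated a _        _        = false

joined : (V → Fin k) → Fin k → Fin k → (V → V → Bool) → V → V → Bool
joined ℓ i j a u v = a u v ∨ ((ℓ u == i) ∧ (ℓ v == j)) ∨ ((ℓ u == j) ∧ (ℓ v == i))

relabelled : Fin k → Fin k → (V → Fin k) → V → Fin k
relabelled i j ℓ v = if ℓ v == i then j else ℓ v

realises-intro : {c : LGraph k} {ℓ : V → Fin k} {a : V → V → Bool} (i : Fin k) →
                 Realises c ℓ a → Realises (step (intro i) c) (maybe ℓ i) (withIsolated a)
realises-intro {c = c} i R = record
  { vertices = mk↔ₛ′ to′ from′ to∘from from∘to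
  ; lab≡     = lab≡′
  ; ladj≡    = ladj≡′
  }
  where
    open Inverse (vertices R) using (from; strictlyInverseˡ; strictlyInverseʳ)
    to′ : Fin (suc (m c)) → Maybe _
    to′ zero    = nothing
    to′ (suc x) = just (to (vertices R) x)
    from′ : Maybe _ → Fin (suc (m c))
    from′ nothing  = zero
    from′ (just v) = suc (from v)
    to∘from : ∀ v → to′ (from′ v) ≡ v
    to∘from nothing  = refl
    to∘from (just v) = cong just (strictlyInverseˡ v)
    from∘to : ∀ x → from′ (to′ x) ≡ x
    from∘to zero    = refl
    from∘to (suc x) = cong suc (strictlyInverseʳ x)
    lab≡′ : ∀ x → lab (step (intro i) c) x ≡ maybe _ i (to′ x)
    lab≡′ zero    = refl
    lab≡′ (suc x) = lab≡ R x
    ladj≡′ : ∀ x y → ladj (step (intro i) c) x y ≡ withIsolated _ (to′ x) (to′ y)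
    ladj≡′ zero    y       = refl
    ladj≡′ (suc x) zero    = refl
    ladj≡′ (suc x) (suc y) = ladj≡ R x y

realises-join : {c : LGraph k} {ℓ : V → Fin k} {a : V → V → Bool} (i j : Fin k) (i≢j : i ≢ j) →
                Realises c ℓ a → Realises (step (join i j i≢j) c) ℓ (joined ℓ i j a)
realises-join {c = c} {ℓ} {a} i j i≢j R = record
  { vertices = vertices R
  ; lab≡     = lab≡ R
  ; ladj≡    = ladj≡′
  }
  where
    ladj≡′ : ∀ x y → ladj (step (join i j i≢j) c) x y
                   ≡ joined ℓ i j a (to (vertices R) x) (to (vertices R) y)
    ladj≡′ x y rewrite ladj≡ R x y | lab≡ R x | lab≡ R y = refl

lab-relabel : (i j : Fin k) (i≢j : i ≢ j) (c : LGraph k) →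
              lab (step (relabel i j i≢j) c) ≗ relabelled i j (lab c)
lab-relabel i j i≢j c x with lab c x == i
... | true  = refl
... | false = refl

realises-relabel : {c : LGraph k} {ℓ : V → Fin k} {a : V → V → Bool} (i j : Fin k) (i≢j : i ≢ j) →
                   Realises c ℓ a → Realises (step (relabel i j i≢j) c) (relabelled i j ℓ) a
realises-relabel {c = c} i j i≢j R = record
  { vertices = vertices R
  ; lab≡     = λ x → trans (lab-relabel i j i≢j c x) (cong (λ l → if l == i then j else l) (lab≡ R x))
  ; ladj≡    = ladj≡ R
  }

glue : (U → U → Bool) → (U → Bool) → (A → A → Bool) → U ⊎ A → U ⊎ A → Bool
glue r x a (inj₁ u) (inj₁ v) = r u v
glue r x a (inj₁ u) (inj₂ _) = x u
glue r x a (inj₂ _) (inj₁ v) = x v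
glue r x a (inj₂ u) (inj₂ v) = a u v

glue-cong : {r : U → U → Bool} {x x′ : U → Bool} {a : A → A → Bool} →
            x ≗ x′ → ∀ u v → glue r x a u v ≡ glue r x′ a u v
glue-cong x≗x′ (inj₁ u) (inj₁ v) = refl
glue-cong x≗x′ (inj₁ u) (inj₂ _) = x≗x′ u
glue-cong x≗x′ (inj₂ _) (inj₁ v) = x≗x′ v
glue-cong x≗x′ (inj₂ u) (inj₂ v) = refl

liftOp : Op k → Op (suc k)
liftOp (intro i)         = intro (suc i)
liftOp (join i j i≢j)    = join (suc i) (suc j) (i≢j ∘ suc-injective)
liftOp (relabel i j i≢j) = relabel (suc i) (suc j) (i≢j ∘ suc-injective)

Beside : LGraph (suc k) → (r : LGraph k) → (A → A → Bool) → Set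
Beside c r a = Realises c [ suc ∘ lab r , const zero ]′ (glue (ladj r) (const false) a)

fresh-↔ : {M : ℕ} → Maybe (Fin M ⊎ A) ↔ (Fin (suc M) ⊎ A)
fresh-↔ {A} {M} = mk↔ₛ′ to′ from′ to∘from from∘to
  where
    to′ : Maybe (Fin M ⊎ A) → Fin (suc M) ⊎ A
    to′ nothing         = inj₁ zero
    to′ (just (inj₁ u)) = inj₁ (suc u)
    to′ (just (inj₂ v)) = inj₂ v
    from′ : Fin (suc M) ⊎ A → Maybe (Fin M ⊎ A)
    from′ (inj₁ zero)    = nothing
    from′ (inj₁ (suc u)) = just (inj₁ u)
    from′ (inj₂ v)       = just (inj₂ v)
    to∘from : ∀ w → to′ (from′ w) ≡ w
    to∘from (inj₁ zero)    = refl
    to∘from (inj₁ (suc u)) = refl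
    to∘from (inj₂ v)       = refl
    from∘to : ∀ w → from′ (to′ w) ≡ w
    from∘to nothing         = refl
    from∘to (just (inj₁ u)) = refl
    from∘to (just (inj₂ v)) = refl

beside-step : {c : LGraph (suc k)} {r : LGraph k} {a : A → A → Bool} (o : Op k) →
              Beside c r a → Beside (step (liftOp o) c) (step o r) a
beside-step {r = r} {a} (intro i) = realises-↔ fresh-↔ lab≡′ ladj≡′ ∘ realises-intro (suc i)
  where
    lab≡′ : ∀ v → maybe [ suc ∘ lab r , const zero ]′ (suc i) v
                ≡ [ suc ∘ lab (step (intro i) r) , const zero ]′ (to fresh-↔ v)
    lab≡′ nothing         = refl
    lab≡′ (just (inj₁ u)) = refl
    lab≡′ (just (inj₂ v)) = refl
    ladj≡′ : ∀ u v → withIsolated (glue (ladj r) (const false) a) u v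
                   ≡ glue (ladj (step (intro i) r)) (const false) a (to fresh-↔ u) (to fresh-↔ v)
    ladj≡′ nothing         nothing         = refl
    ladj≡′ nothing         (just (inj₁ v)) = refl
    ladj≡′ nothing         (just (inj₂ v)) = refl
    ladj≡′ (just (inj₁ u)) nothing         = refl
    ladj≡′ (just (inj₂ u)) nothing         = refl
    ladj≡′ (just (inj₁ u)) (just (inj₁ v)) = refl
    ladj≡′ (just (inj₁ u)) (just (inj₂ v)) = refl
    ladj≡′ (just (inj₂ u)) (just (inj₁ v)) = refl
    ladj≡′ (just (inj₂ u)) (just (inj₂ v)) = refl
beside-step {r = r} {a} (join i j i≢j) =
  realises-≗ (λ _ → refl) ladj≡′ ∘ realises-join (suc i) (suc j) (i≢j ∘ suc-injective)
  where
    ladj≡′ : ∀ u v → joined [ suc ∘ lab r , const zero ]′ (suc i) (suc j)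
                            (glue (ladj r) (const false) a) u v
                   ≡ glue (ladj (step (join i j i≢j) r)) (const false) a u v
    ladj≡′ (inj₁ u) (inj₁ v) = refl
    ladj≡′ (inj₁ u) (inj₂ v) = cong₂ _∨_ (∧-zeroʳ (lab r u == i)) (∧-zeroʳ (lab r u == j))
    ladj≡′ (inj₂ u) (inj₁ v) = refl
    ladj≡′ (inj₂ u) (inj₂ v) = ∨-identityʳ (a u v)
beside-step {r = r} (relabel i j i≢j) =
  realises-≗ lab≡′ (λ _ _ → refl) ∘ realises-relabel (suc i) (suc j) (i≢j ∘ suc-injective)
  where
    lab≡′ : relabelled (suc i) (suc j) [ suc ∘ lab r , const zero ]′
          ≗ [ suc ∘ lab (step (relabel i j i≢j) r) , const zero ]′
    lab≡′ (inj₁ u) = ≡.sym (trans (cong suc (lab-relabel i j i≢j r u)) (if-float suc (lab r u == i)))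
    lab≡′ (inj₂ v) = refl

beside-run : {c : LGraph (suc k)} {r : LGraph k} {a : A → A → Bool} (e : List (Op k)) →
             Beside c r a → Beside (run (map liftOp e) c) (run e r) a
beside-run []      B = B
beside-run (o ∷ e) B = beside-run e (beside-step o B)

any-∈ : {a : Fin k} {is : List (Fin k)} → a ∈ is → any (a ==_) is ≡ true
any-∈ {a = a} {is = _ ∷ is} (here refl) = cong (_∨ any (a ==_) is) (dec-true (a ≟ a) refl)
any-∈ {a = a} (there {x} a∈is)          = trans (cong ((a == x) ∨_) (any-∈ a∈is)) (∨-zeroʳ (a == x))

any-allFin : (a : Fin k) → any (a ==_) (allFin k) ≡ true
any-allFin a = any-∈ (∈-allFin a)

any-allFin-if : (b : Bool) (a : Fin k) → any (a ==_) (if b then allFin k else []) ≡ b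
any-allFin-if true  a = any-allFin a
any-allFin-if false a = refl

joinsWithZero : List (Fin k) → List (Op (suc k))
joinsWithZero = map (λ i → join (suc i) zero (λ ()))

relabelsToZero : List (Fin k) → List (Op (suc k))
relabelsToZero = map (λ i → relabel (suc i) zero (λ ()))

realises-joinsWithZero :
  {c : LGraph (suc k)} {ℓ : U → Fin k} {r : U → U → Bool} {a : A → A → Bool}
  (is : List (Fin k)) (x : U → Bool) →
  Realises c [ suc ∘ ℓ , const zero ]′ (glue r x a) →
  Realises (run (joinsWithZero is) c) [ suc ∘ ℓ , const zero ]′
           (glue r (λ u → x u ∨ any (ℓ u ==_) is) a)
realises-joinsWithZero [] x =
  realises-≗ (λ _ → refl) (glue-cong (≡.sym ∘ ∨-identityʳ ∘ x))
realises-joinsWithZero {ℓ = ℓ} {r} {a} (i ∷ is) x =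
  realises-≗ (λ _ → refl) (glue-cong (λ u → ∨-assoc (x u) (ℓ u == i) _))
  ∘ realises-joinsWithZero is (λ u → x u ∨ (ℓ u == i))
  ∘ realises-≗ (λ _ → refl) ladj≡′
  ∘ realises-join (suc i) zero (λ ())
  where
    ladj≡′ : ∀ u v → joined [ suc ∘ ℓ , const zero ]′ (suc i) zero (glue r x a) u v
                   ≡ glue r (λ u → x u ∨ (ℓ u == i)) a u v
    ladj≡′ (inj₁ u) (inj₁ v) =
      trans (cong (λ y → r u v ∨ y ∨ false) (∧-zeroʳ (ℓ u == i))) (∨-identityʳ (r u v))
    ladj≡′ (inj₁ u) (inj₂ v) = cong (x u ∨_) (trans (∨-identityʳ _) (∧-identityʳ (ℓ u == i)))
    ladj≡′ (inj₂ u) (inj₁ v) = refl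
    ladj≡′ (inj₂ u) (inj₂ v) = ∨-identityʳ (a u v)

sentToZero : (U → Bool) → (U → Fin k) → U → Fin (suc k)
sentToZero x ℓ u = if x u then zero else suc (ℓ u)

sentToZero-cong : {x x′ : U → Bool} {ℓ : U → Fin k} → x ≗ x′ → sentToZero x ℓ ≗ sentToZero x′ ℓ
sentToZero-cong {ℓ = ℓ} x≗x′ u = cong (λ y → if y then zero else suc (ℓ u)) (x≗x′ u)

realises-relabelsToZero :
  {c : LGraph (suc k)} {ℓ : U → Fin k} {a : U ⊎ A → U ⊎ A → Bool}
  (is : List (Fin k)) (x : U → Bool) →
  Realises c [ sentToZero x ℓ , const zero ]′ a →
  Realises (run (relabelsToZero is) c) [ sentToZero (λ u → x u ∨ any (ℓ u ==_) is) ℓ , const zero ]′ a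
realises-relabelsToZero [] x =
  realises-≗ [ sentToZero-cong (≡.sym ∘ ∨-identityʳ ∘ x) , (λ _ → refl) ] (λ _ _ → refl)
realises-relabelsToZero {ℓ = ℓ} (i ∷ is) x =
  realises-≗ [ sentToZero-cong (λ u → ∨-assoc (x u) (ℓ u == i) _) , (λ _ → refl) ] (λ _ _ → refl)
  ∘ realises-relabelsToZero is (λ u → x u ∨ (ℓ u == i))
  ∘ realises-≗ [ relabel-sentToZero , (λ _ → refl) ] (λ _ _ → refl)
  ∘ realises-relabel (suc i) zero (λ ())
  where
    relabel-sentToZero : relabelled (suc i) zero (sentToZero x ℓ)
                       ≗ sentToZero (λ u → x u ∨ (ℓ u == i)) ℓ
    relabel-sentToZero u with x u
    ... | true  = refl
    ... | false = refl

beside-emptyLG : {c : LGraph (suc k)} {a : A → A → Bool} → Realises c (const zero) a → Beside c emptyLG a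
beside-emptyLG = realises-↔ (mk↔ₛ′ inj₂ [ (λ ()) , id ]′ [ (λ ()) , (λ _ → refl) ] (λ _ → refl))
                            (λ _ → refl) (λ _ _ → refl)

block : Bool → List (Op k) → List (Op (suc k))
block {k} b e = map liftOp e ++ joinsWithZero (if b then allFin k else []) ++ relabelsToZero (allFin k)

realises-block : {c : LGraph (suc k)} {a : A → A → Bool} (b : Bool) (e : List (Op k)) →
                 Realises c (const zero) a →
                 Realises (run (block b e) c) (const zero) (glue (ladj (run e emptyLG)) (const b) a)
realises-block {k} {c = c} b e =
  subst (λ c′ → Realises c′ _ _) (≡.sym run-block)
  ∘ realises-≗ [ sentToZero-cong (any-allFin ∘ lab r) , (λ _ → refl) ]
               (glue-cong (any-allFin-if b ∘ lab r))
  ∘ realises-relabelsToZero (allFin k) _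
  ∘ realises-joinsWithZero crossLabels (const false)
  ∘ beside-run e
  ∘ beside-emptyLG
  where
    r = run e emptyLG
    crossLabels = if b then allFin k else []
    run-block : run (block b e) c
              ≡ run (relabelsToZero (allFin k)) (run (joinsWithZero crossLabels) (run (map liftOp e) c))
    run-block = trans (run-++ (map liftOp e) _ c) (run-++ (joinsWithZero crossLabels) _ _)

uniformInflation : {P : Fin h → Set} → Bool → ((v : Fin h) → P v → P v → Bool) →
                   Σ (Fin h) P → Σ (Fin h) P → Bool
uniformInflation b g (zero  , x) (zero  , y) = g zero x y
uniformInflation b g (zero  , _) (suc _ , _) = b
uniformInflation b g (suc _ , _) (zero  , _) = b
uniformInflation b g (suc u , x) (suc v , y) = uniformInflation b (g ∘ suc) (u , x) (v , y)

uniformInflation-diag : {P : Fin h → Set} (b : Bool) (g : (v : Fin h) → P v → P v → Bool) →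
                        ∀ u x y → uniformInflation b g (u , x) (u , y) ≡ g u x y
uniformInflation-diag b g zero    x y = refl
uniformInflation-diag b g (suc u) x y = uniformInflation-diag b (g ∘ suc) u x y

uniformInflation-off : {P : Fin h → Set} (b : Bool) (g : (v : Fin h) → P v → P v → Bool) →
                       ∀ u v x y → u ≢ v → uniformInflation b g (u , x) (v , y) ≡ b
uniformInflation-off b g zero    zero    x y u≢v = contradiction refl u≢v
uniformInflation-off b g zero    (suc v) x y u≢v = refl
uniformInflation-off b g (suc u) zero    x y u≢v = refl
uniformInflation-off b g (suc u) (suc v) x y u≢v = uniformInflation-off b (g ∘ suc) u v x y (u≢v ∘ cong suc)

Homogeneous : Graph (Fin h) → Bool → Set
Homogeneous H b = ∀ u v → u ≢ v → adj H u v ≡ b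

uniformInflation-≡-inflation :
  {P : Fin h → Set} {H : Graph (Fin h)} {G : (v : Fin h) → Graph (P v)} {b : Bool} →
  Homogeneous H b → ∀ p q → uniformInflation b (adj ∘ G) p q ≡ adj (inflation H G) p q
uniformInflation-≡-inflation {G = G} {b} homogeneous (u , x) (v , y) with u ≟ v
... | yes refl = uniformInflation-diag b (adj ∘ G) u x y
... | no u≢v   = trans (uniformInflation-off b (adj ∘ G) u v x y u≢v) (≡.sym (homogeneous u v u≢v))

Σ-suc-↔ : {P : Fin (suc h) → Set} → (P zero ⊎ Σ (Fin h) (P ∘ suc)) ↔ Σ (Fin (suc h)) P
Σ-suc-↔ {h} {P} = mk↔ₛ′ to′ from′ to∘from from∘to
  where
    to′ : P zero ⊎ Σ (Fin h) (P ∘ suc) → Σ (Fin (suc h)) P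
    to′ (inj₁ x)       = zero , x
    to′ (inj₂ (v , x)) = suc v , x
    from′ : Σ (Fin (suc h)) P → P zero ⊎ Σ (Fin h) (P ∘ suc)
    from′ (zero  , x) = inj₁ x
    from′ (suc v , x) = inj₂ (v , x)
    to∘from : ∀ p → to′ (from′ p) ≡ p
    to∘from (zero  , x) = refl
    to∘from (suc v , x) = refl
    from∘to : ∀ p → from′ (to′ p) ≡ p
    from∘to (inj₁ x)       = refl
    from∘to (inj₂ (v , x)) = refl

inflationExpr : Bool → (Fin h → List (Op k)) → List (Op (suc k))
inflationExpr {zero}  b es = []
inflationExpr {suc h} b es = inflationExpr b (es ∘ suc) ++ block b (es zero)

realises-inflationExpr : {P : Fin h → Set} (b : Bool) (g : (v : Fin h) → P v → P v → Bool)
                         (es : Fin h → List (Op k)) → (∀ v → Iso (ladj (run (es v) emptyLG)) (g v)) →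
                         Realises (run (inflationExpr b es) emptyLG) (const zero) (uniformInflation b g)
realises-inflationExpr {zero}  b g es isos = realises-empty
realises-inflationExpr {suc h} b g es isos =
  subst (λ c → Realises c _ _) (≡.sym (run-++ (inflationExpr b (es ∘ suc)) (block b (es zero)) emptyLG))
    (realises-↔ vertices-↔ (λ _ → refl) ladj≡′
      (realises-block b (es zero) (realises-inflationExpr b (g ∘ suc) (es ∘ suc) (isos ∘ suc))))
  where
    vertices-↔ = ↔-trans (⊎-cong (proj₁ (isos zero)) ↔-refl) Σ-suc-↔
    ladj≡′ : ∀ u v → glue (ladj (run (es zero) emptyLG)) (const b) (uniformInflation b (g ∘ suc)) u v
                   ≡ uniformInflation b g (to vertices-↔ u) (to vertices-↔ v)
    ladj≡′ (inj₁ x) (inj₁ y) = proj₂ (isos zero) x y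
    ladj≡′ (inj₁ x) (inj₂ _) = refl
    ladj≡′ (inj₂ _) (inj₁ y) = refl
    ladj≡′ (inj₂ _) (inj₂ _) = refl

lcw-uniformInflation :
  {P : Fin h → Set} {H : Graph (Fin h)} {G : (v : Fin h) → Graph (P v)} {b : Bool} →
  Homogeneous H b → (∀ v → LcwAtMost k (G v)) → LcwAtMost (suc k) (inflation H G)
lcw-uniformInflation {G = G} {b} homogeneous lcw =
  inflationExpr b (proj₁ ∘ lcw) ,
  realises⇒iso (realises-≗ (λ _ → refl) (uniformInflation-≡-inflation homogeneous)
                 (realises-inflationExpr b (adj ∘ G) (proj₁ ∘ lcw) (proj₂ ∘ lcw)))

proposition3p3 : (h : ℕ) (H : Graph (Fin h)) (n : Fin h → ℕ) (G : (v : Fin h) → Graph (Fin (n v)))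
  → Complete H ⊎ AntiComplete H
  → (∀ v → 1 ≤ n v)
  → (k : ℕ) → (∀ v → LcwAtMost k (G v))
  → LcwAtMost (suc k) (inflation H G)
proposition3p3 h H n G (inj₁ complete)     _ k = lcw-uniformInflation complete
proposition3p3 h H n G (inj₂ antiComplete) _ k = lcw-uniformInflation {H = H} (λ u v _ → antiComplete u v)
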